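{- Let $\varphi=\forall y_1\dots\forall y_m.\phi$, where $\phi$ is a boolean combination of test formulae containing no occurrence of $\mathsf{alloc}(y_i)$ at positive polarity, for any $i\in[1,m]$. Then $\tau(\varphi)$ is equivalent to a $\mathsf{BSR}(\mathsf{FO})$ formula having the same constants and free variables as $\tau(\varphi)$.
   Context: Fix $k\ge1$. Test formulae are the formulae $x\approx y$, $x\hookrightarrow(y_1,\dots,y_k)$, $\mathsf{alloc}(x)$, $|h|\ge n$ ($n\in\mathbb N\cup\{\infty\}$), $|U|\ge n$ and $|h|\ge|U|-n$ ($n\in\mathbb N$), for variables $x,y,y_i$. An occurrence in a boolean combination is at positive polarity if it lies under an even number of negations. The translation $\tau$ into first-order logic uses a boolean $(k+1)$-ary symbol $\mathfrak p$ and boolean constants $\mathfrak a_n,\mathfrak b_n,\mathfrak c_n$. It is defined by: - $\tau(|h|\ge n)=\mathfrak a_n$; - $\tau(|U|\ge n)=\mathfrak b_n$; - $\tau(|h|\ge|U|-n)=\neg\mathfrak c_{n+1}$; - $\tau(x\hookrightarrow\vec y)=\mathfrak p(x,\vec y)$; - $\tau(\mathsf{alloc}(x))=\exists z_1\dots\exists z_k.\mathfrak p(x,z_1,\dots,z_k)$; - $\tau(x\approx y)=x\approx y$; - $\tau$ commutes with $\wedge$, $\neg$, $\exists$ and $\forall$. A $\mathsf{BSR}(\mathsf{FO})$ formula is a formula $\exists x_1\dots\exists x_n\forall z_1\dots\forall z_p.\psi$ with $\psi$ quantifier-free, in which every function symbol of positive arity has boolean result sort (free variables are allowed). -}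

module Defs where

open import Level using (0ℓ)
open import Data.Nat using (ℕ; zero; suc; _+_; _≟_)
open import Data.Bool using (Bool; true; false; not)
open import Data.Fin using (Fin; toℕ)
open import Data.Vec using (Vec; _∷_; []; map; tabulate)
open import Data.List using (List)
open import Data.Vec.Membership.Propositional renaming (_∈_ to _∈ᵛ_)
open import Data.Product using (Σ; _×_; _,_)
open import Data.Sum using (_⊎_)
open import Relation.Nullary using (¬_; yes; no)
open import Relation.Binary.PropositionalEquality using (_≡_)
open import Function.Bundles using (_⇔_)

Var : Set
Var = ℕ

data ℕ∞ : Set where
  fin : ℕ → ℕ∞
  ∞   : ℕ∞

data Test (k : ℕ) : Set where
  _≈ₜ_   : Var → Var → Test k
  _↪_    : Var → Vec Var k → Test k
  alloc  : Var → Test k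
  |h|≥_  : ℕ∞ → Test k
  |U|≥_  : ℕ → Test k
  |h|≥|U|-_ : ℕ → Test k

data BC (k : ℕ) : Set where
  atom : Test k → BC k
  _∧_  : BC k → BC k → BC k
  ¬ᵇ_  : BC k → BC k

-- AllocAt p y ϕ : ϕ has an occurrence of alloc(y) at polarity p
-- (true = positive = under an even number of negations).
data AllocAt {k : ℕ} : Bool → Var → BC k → Set where
  here : ∀ {y} → AllocAt true y (atom (alloc y))
  ∧ˡ   : ∀ {p y ϕ ψ} → AllocAt p y ϕ → AllocAt p y (ϕ ∧ ψ)
  ∧ʳ   : ∀ {p y ϕ ψ} → AllocAt p y ψ → AllocAt p y (ϕ ∧ ψ)
  ¬ᵃ   : ∀ {p y ϕ} → AllocAt p y ϕ → AllocAt (not p) y (¬ᵇ ϕ)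

data Const : Set where
  𝔞 : ℕ∞ → Const
  𝔟 : ℕ → Const
  𝔠 : ℕ → Const

data FO (k : ℕ) : Set where
  _≐_  : Var → Var → FO k
  𝔭    : Vec Var (suc k) → FO k
  cst  : Const → FO k
  _∧ᶠ_ : FO k → FO k → FO k
  ¬ᶠ_  : FO k → FO k
  ∃ᶠ   : Var → FO k → FO k
  ∀ᶠ   : Var → FO k → FO k

record Structure (k : ℕ) : Set₁ where
  field
    D   : Set
    inh : D
    P   : Vec D (suc k) → Bool
    I   : Const → Bool

open Structure public

update : {D : Set} → (Var → D) → Var → D → Var → D
update ν x d y with y ≟ x
... | yes _ = d
... | no _  = ν y

⟦_⟧ : {k : ℕ} → FO k → (S : Structure k) → (Var → D S) → Set
⟦ x ≐ y ⟧ S ν = ν x ≡ ν y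
⟦ 𝔭 xs ⟧ S ν = P S (map ν xs) ≡ true
⟦ cst c ⟧ S ν = I S c ≡ true
⟦ φ ∧ᶠ ψ ⟧ S ν = ⟦ φ ⟧ S ν × ⟦ ψ ⟧ S ν
⟦ ¬ᶠ φ ⟧ S ν = ¬ ⟦ φ ⟧ S ν
⟦ ∃ᶠ x φ ⟧ S ν = Σ (D S) λ d → ⟦ φ ⟧ S (update ν x d)
⟦ ∀ᶠ x φ ⟧ S ν = (d : D S) → ⟦ φ ⟧ S (update ν x d)

_≡ᶠ_ : {k : ℕ} → FO k → FO k → Set₁
φ ≡ᶠ ψ = ∀ S ν → ⟦ φ ⟧ S ν ⇔ ⟦ ψ ⟧ S ν

data Free {k : ℕ} (x : Var) : FO k → Set where
  ≐ˡ  : ∀ {y} → Free x (x ≐ y)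
  ≐ʳ  : ∀ {y} → Free x (y ≐ x)
  𝔭∈  : ∀ {xs} → x ∈ᵛ xs → Free x (𝔭 xs)
  ∧ˡ  : ∀ {φ ψ} → Free x φ → Free x (φ ∧ᶠ ψ)
  ∧ʳ  : ∀ {φ ψ} → Free x ψ → Free x (φ ∧ᶠ ψ)
  ¬f  : ∀ {φ} → Free x φ → Free x (¬ᶠ φ)
  ∃f  : ∀ {y φ} → ¬ (x ≡ y) → Free x φ → Free x (∃ᶠ y φ)
  ∀f  : ∀ {y φ} → ¬ (x ≡ y) → Free x φ → Free x (∀ᶠ y φ)

data HasConst {k : ℕ} (c : Const) : FO k → Set where
  here : HasConst c (cst c)
  ∧ˡ   : ∀ {φ ψ} → HasConst c φ → HasConst c (φ ∧ᶠ ψ)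
  ∧ʳ   : ∀ {φ ψ} → HasConst c ψ → HasConst c (φ ∧ᶠ ψ)
  ¬c   : ∀ {φ} → HasConst c φ → HasConst c (¬ᶠ φ)
  ∃c   : ∀ {y φ} → HasConst c φ → HasConst c (∃ᶠ y φ)
  ∀c   : ∀ {y φ} → HasConst c φ → HasConst c (∀ᶠ y φ)

-- BSR(FO): ∃x₁…∃xₙ ∀z₁…∀z_p. ψ with ψ quantifier-free
-- (every positive-arity symbol of the signature, 𝔭, is boolean).
data QF {k : ℕ} : FO k → Set where
  ≐q   : ∀ {x y} → QF (x ≐ y)
  𝔭q   : ∀ {xs} → QF (𝔭 xs)
  cq   : ∀ {c} → QF (cst c)
  ∧q   : ∀ {φ ψ} → QF φ → QF ψ → QF (φ ∧ᶠ ψ)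
  ¬q   : ∀ {φ} → QF φ → QF (¬ᶠ φ)

data UnivPrefix {k : ℕ} : FO k → Set where
  qf  : ∀ {φ} → QF φ → UnivPrefix φ
  ∀u  : ∀ {x φ} → UnivPrefix φ → UnivPrefix (∀ᶠ x φ)

data BSR {k : ℕ} : FO k → Set where
  univ : ∀ {φ} → UnivPrefix φ → BSR φ
  ∃b   : ∀ {x φ} → BSR φ → BSR (∃ᶠ x φ)

∃ᵛ : {k n : ℕ} → Vec Var n → FO k → FO k
∃ᵛ [] φ = φ
∃ᵛ (z ∷ zs) φ = ∃ᶠ z (∃ᵛ zs φ)

-- bound variables for τ(alloc(x)): z_i = x + 1 + i, pairwise distinct and ≠ x
allocVars : (k : ℕ) → Var → Vec Var k
allocVars k x = tabulate (λ i → suc x + toℕ i)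

τₜ : {k : ℕ} → Test k → FO k
τₜ (x ≈ₜ y) = x ≐ y
τₜ (x ↪ ys) = 𝔭 (x ∷ ys)
τₜ {k} (alloc x) = ∃ᵛ (allocVars k x) (𝔭 (x ∷ allocVars k x))
τₜ (|h|≥ n) = cst (𝔞 n)
τₜ (|U|≥ n) = cst (𝔟 n)
τₜ (|h|≥|U|- n) = ¬ᶠ cst (𝔠 (suc n))

τ : {k : ℕ} → BC k → FO k
τ (atom t) = τₜ t
τ (ϕ ∧ ψ) = τ ϕ ∧ᶠ τ ψ
τ (¬ᵇ ϕ) = ¬ᶠ τ ϕ

∀ˡ : {k : ℕ} → List Var → FO k → FO k
∀ˡ ys φ = Data.List.foldr ∀ᶠ φ ys

-- In τ(φ) each alloc(x) is the block ∃z⃗. 𝔭(x, z⃗). At positive polarity x is not among the yᵢ, so it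
-- is free and the block can be Skolemised: it becomes 𝔭(x, w⃗ₓ) with w⃗ₓ fresh and quantified
-- existentially in front of ∀y⃗, since its value depends on x only. At negative polarity the block is
-- universal and becomes 𝔭(x, u⃗ₓ) with u⃗ₓ added to the universal prefix. The result ∃w⃗ ∀y⃗ ∀u⃗. ψ₀ is
-- in BSR(FO); choosing the Skolem witnesses uses excluded middle.
module Submission where

open import Defs
open import Level using (0ℓ)
open import Function using (_∘_)
open import Data.Nat using (ℕ; suc; _+_; _*_; _∸_; _≤_; _<_; _≟_; _⊔_; s≤s; z≤n; NonZero; _/_; _%_)
open import Data.Nat.Properties
open import Data.Nat.DivMod using (_mod_; [m+kn]%n≡m%n; m<n⇒m%n≡m; m%n<n; m*n/n≡m; m<n⇒m/n≡0; +-distrib-/-∣ˡ)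
open import Data.Nat.Divisibility using (n∣m*n)
open import Data.Bool using (Bool; true; false; not; if_then_else_)
open import Data.Bool.Properties using (not-involutive)
open import Data.Fin using (Fin; toℕ)
open import Data.Fin.Properties using (toℕ-injective; toℕ-fromℕ<; toℕ<n)
open import Data.Vec using (Vec; _∷_; []; map; tabulate; lookup; toList; replicate)
open import Data.Vec.Properties using (tabulate-cong; tabulate-∘; tabulate∘lookup)
open import Data.Vec.Relation.Unary.Any using (here; there)
import Data.Vec.Relation.Unary.All as Allᵛ
open import Data.Vec.Relation.Unary.All.Properties using (tabulate⁺)
open import Data.Vec.Membership.Propositional using () renaming (_∈_ to _∈ᵛ_)
open import Data.Vec.Membership.Propositional.Properties using (∈-toList⁺; ∈-toList⁻)
open import Data.List using (List; []; _∷_; foldr; applyUpTo)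
open import Data.List.Relation.Unary.Any using (here; there)
open import Data.List.Membership.Propositional using (_∈_; _∉_)
open import Data.List.Membership.Propositional.Properties using (∈-applyUpTo⁺; ∈-applyUpTo⁻)
open import Data.List.Membership.DecPropositional _≟_ using (_∈?_)
open import Data.Product using (Σ; _×_; _,_; proj₁; proj₂)
open import Relation.Nullary using (¬_; Dec; yes; no; contradiction)
open import Relation.Binary.PropositionalEquality using (_≡_; _≢_; refl; sym; trans; cong; cong₂; subst; module ≡-Reasoning)
open import Function.Bundles using (_⇔_; mk⇔)
open import Axiom.ExcludedMiddle using (ExcludedMiddle)

∃ˡ : {k : ℕ} → List Var → FO k → FO k
∃ˡ L φ = foldr ∃ᶠ φ L

infix 4 _≗_off_

_≗_off_ : {A : Set} → (Var → A) → (Var → A) → List Var → Set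
μ ≗ ν off L = ∀ v → v ∉ L → μ v ≡ ν v

update-other : {A : Set} (ν : Var → A) (z : Var) (d : A) (v : Var) → v ≢ z → update ν z d v ≡ ν v
update-other ν z d v v≢z with v ≟ z
... | yes v≡z = contradiction v≡z v≢z
... | no _ = refl

update-cong : {A : Set} (μ ν : Var → A) (z : Var) (d : A) (v : Var)
  → (v ≢ z → μ v ≡ ν v) → update μ z d v ≡ update ν z d v
update-cong μ ν z d v eq with v ≟ z
... | yes _ = refl
... | no v≢z = eq v≢z

≗-off-∷ : {A : Set} {μ ν : Var → A} {z : Var} {d : A} {zs : List Var}
  → μ ≗ update ν z d off zs → μ ≗ ν off (z ∷ zs)
≗-off-∷ {ν = ν} {z} {d} eq v v∉ = trans (eq v (v∉ ∘ there)) (update-other ν z d v (v∉ ∘ here))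

≗-off-update : {A : Set} {μ ν : Var → A} {z : Var} {zs : List Var}
  → μ ≗ ν off (z ∷ zs) → μ ≗ update ν z (μ z) off zs
≗-off-update {z = z} eq v v∉ with v ≟ z
... | yes refl = refl
... | no v≢z = eq v λ { (here v≡z) → v≢z v≡z ; (there v∈) → v∉ v∈ }

_⟨_≔_⟩ : {A : Set} → (Var → A) → List Var → (Var → A) → Var → A
(ν ⟨ L ≔ g ⟩) v with v ∈? L
... | yes _ = g v
... | no _ = ν v

≔-cases : {A : Set} (ν : Var → A) (L : List Var) (g h : Var → A) {v : Var}
  → (v ∈ L → g v ≡ h v) → (v ∉ L → ν v ≡ h v) → (ν ⟨ L ≔ g ⟩) v ≡ h v
≔-cases ν L g h {v} in-case off-case with v ∈? L
... | yes v∈ = in-case v∈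
... | no v∉ = off-case v∉

≔-in : {A : Set} (ν : Var → A) (L : List Var) (g : Var → A) {v : Var} → v ∈ L → (ν ⟨ L ≔ g ⟩) v ≡ g v
≔-in ν L g v∈ = ≔-cases ν L g g (λ _ → refl) (contradiction v∈)

≔-off : {A : Set} (ν : Var → A) (L : List Var) (g : Var → A) → ν ⟨ L ≔ g ⟩ ≗ ν off L
≔-off ν L g v v∉ = ≔-cases ν L g ν (λ v∈ → contradiction v∈ v∉) (λ _ → refl)

map-cong-∈ : {A B : Set} {n : ℕ} {f g : A → B} (xs : Vec A n)
  → (∀ v → v ∈ᵛ xs → f v ≡ g v) → map f xs ≡ map g xs
map-cong-∈ [] eq = refl
map-cong-∈ (x ∷ xs) eq = cong₂ _∷_ (eq x (here refl)) (map-cong-∈ xs (λ v v∈ → eq v (there v∈)))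

map-≔ : {A : Set} {n : ℕ} (ν : Var → A) (L : List Var) (g : Var → A) (zs : Vec Var n)
  → (∀ v → v ∈ᵛ zs → v ∈ L) → map (ν ⟨ L ≔ g ⟩) zs ≡ map g zs
map-≔ ν L g zs zs⊆L = map-cong-∈ zs (λ v v∈ → ≔-in ν L g (zs⊆L v v∈))

module _ {k : ℕ} (S : Structure k) where

  ⟦⟧-coincidence : ∀ φ {μ μ'} → (∀ x → Free x φ → μ x ≡ μ' x) → ⟦ φ ⟧ S μ → ⟦ φ ⟧ S μ'
  ⟦⟧-coincidence (x ≐ y) eq H = trans (sym (eq x ≐ˡ)) (trans H (eq y ≐ʳ))
  ⟦⟧-coincidence (𝔭 xs) eq H = trans (cong (P S) (map-cong-∈ xs (λ v v∈ → sym (eq v (𝔭∈ v∈))))) H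
  ⟦⟧-coincidence (cst c) eq H = H
  ⟦⟧-coincidence (φ ∧ᶠ ψ) eq (Hφ , Hψ) =
    ⟦⟧-coincidence φ (λ x F → eq x (∧ˡ F)) Hφ , ⟦⟧-coincidence ψ (λ x F → eq x (∧ʳ F)) Hψ
  ⟦⟧-coincidence (¬ᶠ φ) eq ¬H H = ¬H (⟦⟧-coincidence φ (λ x F → sym (eq x (¬f F))) H)
  ⟦⟧-coincidence (∃ᶠ y φ) {μ} {μ'} eq (d , H) =
    d , ⟦⟧-coincidence φ (λ x F → update-cong μ μ' y d x (λ x≢y → eq x (∃f x≢y F))) H
  ⟦⟧-coincidence (∀ᶠ y φ) {μ} {μ'} eq H d =
    ⟦⟧-coincidence φ (λ x F → update-cong μ μ' y d x (λ x≢y → eq x (∀f x≢y F))) (H d)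

  ∀ˡ-intro : ∀ L φ ν → (∀ μ → μ ≗ ν off L → ⟦ φ ⟧ S μ) → ⟦ ∀ˡ L φ ⟧ S ν
  ∀ˡ-intro [] φ ν H = H ν (λ _ _ → refl)
  ∀ˡ-intro (z ∷ zs) φ ν H d = ∀ˡ-intro zs φ (update ν z d) (λ μ eq → H μ (≗-off-∷ eq))

  -- Without function extensionality, the valuation reached at the end of the block is only
  -- pointwise equal to μ; coincidence bridges the gap.
  ∀ˡ-elim : ∀ L φ ν → ⟦ ∀ˡ L φ ⟧ S ν → ∀ μ → μ ≗ ν off L → ⟦ φ ⟧ S μ
  ∀ˡ-elim [] φ ν H μ eq = ⟦⟧-coincidence φ (λ x _ → sym (eq x λ ())) H
  ∀ˡ-elim (z ∷ zs) φ ν H μ eq = ∀ˡ-elim zs φ (update ν z (μ z)) (H (μ z)) μ (≗-off-update eq)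

  ∃ˡ-intro : ∀ L φ ν μ → μ ≗ ν off L → ⟦ φ ⟧ S μ → ⟦ ∃ˡ L φ ⟧ S ν
  ∃ˡ-intro [] φ ν μ eq H = ⟦⟧-coincidence φ (λ x _ → eq x λ ()) H
  ∃ˡ-intro (z ∷ zs) φ ν μ eq H = μ z , ∃ˡ-intro zs φ (update ν z (μ z)) μ (≗-off-update eq) H

  ∃ˡ-elim : ∀ L φ ν → ⟦ ∃ˡ L φ ⟧ S ν → Σ (Var → D S) λ μ → μ ≗ ν off L × ⟦ φ ⟧ S μ
  ∃ˡ-elim [] φ ν H = ν , (λ _ _ → refl) , H
  ∃ˡ-elim (z ∷ zs) φ ν (d , H) with ∃ˡ-elim zs φ (update ν z d) H
  ... | μ , eq , Hμ = μ , ≗-off-∷ eq , Hμ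

module _ {k : ℕ} {x : Var} where

  Free-∀ˡ⁻ : ∀ L (φ : FO k) → Free x (∀ˡ L φ) → x ∉ L × Free x φ
  Free-∀ˡ⁻ [] φ F = (λ ()) , F
  Free-∀ˡ⁻ (z ∷ zs) φ (∀f x≢z F) with Free-∀ˡ⁻ zs φ F
  ... | x∉zs , Fφ = (λ { (here x≡z) → x≢z x≡z ; (there x∈) → x∉zs x∈ }) , Fφ

  Free-∀ˡ⁺ : ∀ L (φ : FO k) → x ∉ L → Free x φ → Free x (∀ˡ L φ)
  Free-∀ˡ⁺ [] φ x∉ F = F
  Free-∀ˡ⁺ (z ∷ zs) φ x∉ F = ∀f (x∉ ∘ here) (Free-∀ˡ⁺ zs φ (x∉ ∘ there) F)

  Free-∃ˡ⁻ : ∀ L (φ : FO k) → Free x (∃ˡ L φ) → x ∉ L × Free x φ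
  Free-∃ˡ⁻ [] φ F = (λ ()) , F
  Free-∃ˡ⁻ (z ∷ zs) φ (∃f x≢z F) with Free-∃ˡ⁻ zs φ F
  ... | x∉zs , Fφ = (λ { (here x≡z) → x≢z x≡z ; (there x∈) → x∉zs x∈ }) , Fφ

  Free-∃ˡ⁺ : ∀ L (φ : FO k) → x ∉ L → Free x φ → Free x (∃ˡ L φ)
  Free-∃ˡ⁺ [] φ x∉ F = F
  Free-∃ˡ⁺ (z ∷ zs) φ x∉ F = ∃f (x∉ ∘ here) (Free-∃ˡ⁺ zs φ (x∉ ∘ there) F)

module _ {k : ℕ} {c : Const} where

  HasConst-∀ˡ⁻ : ∀ L (φ : FO k) → HasConst c (∀ˡ L φ) → HasConst c φ
  HasConst-∀ˡ⁻ [] φ H = H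
  HasConst-∀ˡ⁻ (z ∷ zs) φ (∀c H) = HasConst-∀ˡ⁻ zs φ H

  HasConst-∀ˡ⁺ : ∀ L (φ : FO k) → HasConst c φ → HasConst c (∀ˡ L φ)
  HasConst-∀ˡ⁺ [] φ H = H
  HasConst-∀ˡ⁺ (z ∷ zs) φ H = ∀c (HasConst-∀ˡ⁺ zs φ H)

  HasConst-∃ˡ⁻ : ∀ L (φ : FO k) → HasConst c (∃ˡ L φ) → HasConst c φ
  HasConst-∃ˡ⁻ [] φ H = H
  HasConst-∃ˡ⁻ (z ∷ zs) φ (∃c H) = HasConst-∃ˡ⁻ zs φ H

  HasConst-∃ˡ⁺ : ∀ L (φ : FO k) → HasConst c φ → HasConst c (∃ˡ L φ)
  HasConst-∃ˡ⁺ [] φ H = H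
  HasConst-∃ˡ⁺ (z ∷ zs) φ H = ∃c (HasConst-∃ˡ⁺ zs φ H)

module _ {k : ℕ} where

  ∀ˡ-UnivPrefix : ∀ L {φ : FO k} → UnivPrefix φ → UnivPrefix (∀ˡ L φ)
  ∀ˡ-UnivPrefix [] U = U
  ∀ˡ-UnivPrefix (z ∷ zs) U = ∀u (∀ˡ-UnivPrefix zs U)

  ∃ˡ-BSR : ∀ L {φ : FO k} → BSR φ → BSR (∃ˡ L φ)
  ∃ˡ-BSR [] B = B
  ∃ˡ-BSR (z ∷ zs) B = ∃b (∃ˡ-BSR zs B)

  ∃ᵛ≡∃ˡ : ∀ {n} (zs : Vec Var n) (φ : FO k) → ∃ᵛ zs φ ≡ ∃ˡ (toList zs) φ
  ∃ᵛ≡∃ˡ [] φ = refl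
  ∃ᵛ≡∃ˡ (z ∷ zs) φ = cong (∃ᶠ z) (∃ᵛ≡∃ˡ zs φ)

supVec : ∀ {n} → Vec Var n → ℕ
supVec [] = 0
supVec (x ∷ xs) = suc x ⊔ supVec xs

supVar : {k : ℕ} → FO k → ℕ
supVar (x ≐ y) = suc x ⊔ suc y
supVar (𝔭 xs) = supVec xs
supVar (cst c) = 0
supVar (φ ∧ᶠ ψ) = supVar φ ⊔ supVar ψ
supVar (¬ᶠ φ) = supVar φ
supVar (∃ᶠ y φ) = suc y ⊔ supVar φ
supVar (∀ᶠ y φ) = suc y ⊔ supVar φ

∈⇒<supVec : ∀ {n x} (xs : Vec Var n) → x ∈ᵛ xs → x < supVec xs
∈⇒<supVec (x ∷ xs) (here refl) = m≤m⊔n (suc x) (supVec xs)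
∈⇒<supVec (y ∷ xs) (there x∈) = <-≤-trans (∈⇒<supVec xs x∈) (m≤n⊔m (suc y) (supVec xs))

Free⇒<supVar : {k : ℕ} {x : Var} (φ : FO k) → Free x φ → x < supVar φ
Free⇒<supVar (x ≐ y) ≐ˡ = m≤m⊔n (suc x) (suc y)
Free⇒<supVar (y ≐ x) ≐ʳ = m≤n⊔m (suc y) (suc x)
Free⇒<supVar (𝔭 xs) (𝔭∈ x∈) = ∈⇒<supVec xs x∈
Free⇒<supVar (φ ∧ᶠ ψ) (∧ˡ F) = <-≤-trans (Free⇒<supVar φ F) (m≤m⊔n (supVar φ) (supVar ψ))
Free⇒<supVar (φ ∧ᶠ ψ) (∧ʳ F) = <-≤-trans (Free⇒<supVar ψ F) (m≤n⊔m (supVar φ) (supVar ψ))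
Free⇒<supVar (¬ᶠ φ) (¬f F) = Free⇒<supVar φ F
Free⇒<supVar (∃ᶠ y φ) (∃f _ F) = <-≤-trans (Free⇒<supVar φ F) (m≤n⊔m (suc y) (supVar φ))
Free⇒<supVar (∀ᶠ y φ) (∀f _ F) = <-≤-trans (Free⇒<supVar φ F) (m≤n⊔m (suc y) (supVar φ))

∈⇒<supVar-∀ˡ : {k : ℕ} {y : Var} (ys : List Var) (φ : FO k) → y ∈ ys → y < supVar (∀ˡ ys φ)
∈⇒<supVar-∀ˡ (y ∷ ys) φ (here refl) = m≤m⊔n (suc y) (supVar (∀ˡ ys φ))
∈⇒<supVar-∀ˡ (z ∷ ys) φ (there y∈) = <-≤-trans (∈⇒<supVar-∀ˡ ys φ y∈) (m≤n⊔m (suc z) (supVar (∀ˡ ys φ)))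

Allocated : {k : ℕ} (S : Structure k) → D S → Set
Allocated {k} S d = Σ (Vec (D S) k) λ ds → P S (d ∷ ds) ≡ true

module _ {k : ℕ} (y : Var) where

  τalloc≡∃ˡ : τₜ {k} (alloc y) ≡ ∃ˡ (toList (allocVars k y)) (𝔭 (y ∷ allocVars k y))
  τalloc≡∃ˡ = ∃ᵛ≡∃ˡ (allocVars k y) (𝔭 (y ∷ allocVars k y))

  allocVars-fresh : y ∉ toList (allocVars k y)
  allocVars-fresh y∈ = Allᵛ.lookup (tabulate⁺ {P = y ≢_} (λ i → m≢1+m+n y)) (∈-toList⁻ y∈) refl

  Free-τalloc⁻ : ∀ {x} → Free x (τₜ {k} (alloc y)) → x ≡ y
  Free-τalloc⁻ F rewrite τalloc≡∃ˡ with Free-∃ˡ⁻ (toList (allocVars k y)) (𝔭 (y ∷ allocVars k y)) F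
  ... | _ , 𝔭∈ (here x≡y) = x≡y
  ... | x∉ , 𝔭∈ (there x∈) = contradiction (∈-toList⁺ x∈) x∉

  Free-τalloc⁺ : Free y (τₜ {k} (alloc y))
  Free-τalloc⁺ rewrite τalloc≡∃ˡ = Free-∃ˡ⁺ (toList (allocVars k y)) _ allocVars-fresh (𝔭∈ (here refl))

  ¬HasConst-τalloc : ∀ {c} → ¬ HasConst c (τₜ {k} (alloc y))
  ¬HasConst-τalloc H rewrite τalloc≡∃ˡ with HasConst-∃ˡ⁻ (toList (allocVars k y)) (𝔭 (y ∷ allocVars k y)) H
  ... | ()

  τalloc⇒Allocated : (S : Structure k) (μ : Var → D S) → ⟦ τₜ (alloc y) ⟧ S μ → Allocated S (μ y)
  τalloc⇒Allocated S μ H rewrite τalloc≡∃ˡ with ∃ˡ-elim S (toList (allocVars k y)) (𝔭 (y ∷ allocVars k y)) μ H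
  ... | μ' , μ'≗μ , Hμ' =
    map μ' (allocVars k y) , subst (λ d → P S (d ∷ map μ' (allocVars k y)) ≡ true) (μ'≗μ y allocVars-fresh) Hμ'

AllocAt⇒Free : ∀ {k q y} {ϕ : BC k} → AllocAt q y ϕ → Free y (τ ϕ)
AllocAt⇒Free {y = y} here = Free-τalloc⁺ y
AllocAt⇒Free (∧ˡ o) = ∧ˡ (AllocAt⇒Free o)
AllocAt⇒Free (∧ʳ o) = ∧ʳ (AllocAt⇒Free o)
AllocAt⇒Free (¬ᵃ o) = ¬f (AllocAt⇒Free o)

infix 3 _⇒[_]_

_⇒[_]_ : Set → Bool → Set → Set
A ⇒[ true ] B = A → B
A ⇒[ false ] B = B → A

⇔⇒⇒[] : ∀ {A B} p → (A → B) → (B → A) → A ⇒[ p ] B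
⇔⇒⇒[] true A→B B→A = A→B
⇔⇒⇒[] false A→B B→A = B→A

×-⇒[] : ∀ {A B C E} p → A ⇒[ p ] B → C ⇒[ p ] E → (A × C) ⇒[ p ] (B × E)
×-⇒[] true f g (a , c) = f a , g c
×-⇒[] false f g (b , e) = f b , g e

¬-⇒[] : ∀ {A B} p → A ⇒[ not p ] B → (¬ A) ⇒[ p ] (¬ B)
¬-⇒[] true f ¬A b = ¬A (f b)
¬-⇒[] false f ¬B a = ¬B (f a)

τ[_] : {k : ℕ} → (Bool → Var → FO k) → Bool → BC k → FO k
τ[ σ ] p (atom (alloc x)) = σ p x
τ[ σ ] p (atom t) = τₜ t
τ[ σ ] p (ϕ ∧ ψ) = τ[ σ ] p ϕ ∧ᶠ τ[ σ ] p ψ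
τ[ σ ] p (¬ᵇ ϕ) = ¬ᶠ τ[ σ ] (not p) ϕ

τalloc : {k : ℕ} → Bool → Var → FO k
τalloc _ x = τₜ (alloc x)

τ≡τ[τalloc] : {k : ℕ} (p : Bool) (ϕ : BC k) → τ ϕ ≡ τ[ τalloc ] p ϕ
τ≡τ[τalloc] p (atom (_ ≈ₜ _)) = refl
τ≡τ[τalloc] p (atom (_ ↪ _)) = refl
τ≡τ[τalloc] p (atom (alloc x)) = refl
τ≡τ[τalloc] p (atom (|h|≥ _)) = refl
τ≡τ[τalloc] p (atom (|U|≥ _)) = refl
τ≡τ[τalloc] p (atom (|h|≥|U|- _)) = refl
τ≡τ[τalloc] p (ϕ ∧ ψ) = cong₂ _∧ᶠ_ (τ≡τ[τalloc] p ϕ) (τ≡τ[τalloc] p ψ)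
τ≡τ[τalloc] p (¬ᵇ ϕ) = cong ¬ᶠ_ (τ≡τ[τalloc] (not p) ϕ)

module _ {k : ℕ} (σ : Bool → Var → FO k) where

  QF-τ[] : (∀ r y → QF (σ r y)) → ∀ p ϕ → QF (τ[ σ ] p ϕ)
  QF-τ[] σ-QF p (atom (_ ≈ₜ _)) = ≐q
  QF-τ[] σ-QF p (atom (_ ↪ _)) = 𝔭q
  QF-τ[] σ-QF p (atom (alloc x)) = σ-QF p x
  QF-τ[] σ-QF p (atom (|h|≥ _)) = cq
  QF-τ[] σ-QF p (atom (|U|≥ _)) = cq
  QF-τ[] σ-QF p (atom (|h|≥|U|- _)) = ¬q cq
  QF-τ[] σ-QF p (ϕ ∧ ψ) = ∧q (QF-τ[] σ-QF p ϕ) (QF-τ[] σ-QF p ψ)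
  QF-τ[] σ-QF p (¬ᵇ ϕ) = ¬q (QF-τ[] σ-QF (not p) ϕ)

module _ {k : ℕ} (σ σ' : Bool → Var → FO k) where

  HasConst-τ[] : ∀ {c} → (∀ r y → ¬ HasConst c (σ r y))
    → ∀ p ϕ → HasConst c (τ[ σ ] p ϕ) → HasConst c (τ[ σ' ] p ϕ)
  HasConst-τ[] no-c p (atom (_ ≈ₜ _)) H = H
  HasConst-τ[] no-c p (atom (_ ↪ _)) H = H
  HasConst-τ[] no-c p (atom (alloc x)) H = contradiction H (no-c p x)
  HasConst-τ[] no-c p (atom (|h|≥ _)) H = H
  HasConst-τ[] no-c p (atom (|U|≥ _)) H = H
  HasConst-τ[] no-c p (atom (|h|≥|U|- _)) H = H
  HasConst-τ[] no-c p (ϕ ∧ ψ) (∧ˡ H) = ∧ˡ (HasConst-τ[] no-c p ϕ H)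
  HasConst-τ[] no-c p (ϕ ∧ ψ) (∧ʳ H) = ∧ʳ (HasConst-τ[] no-c p ψ H)
  HasConst-τ[] no-c p (¬ᵇ ϕ) (¬c H) = ¬c (HasConst-τ[] no-c (not p) ϕ H)

  Free-τ[] : ∀ {x} p ϕ → (∀ q r y → AllocAt q y ϕ → Free x (σ r y) → Free x (σ' r y))
    → Free x (τ[ σ ] p ϕ) → Free x (τ[ σ' ] p ϕ)
  Free-τ[] p (atom (_ ≈ₜ _)) tr F = F
  Free-τ[] p (atom (_ ↪ _)) tr F = F
  Free-τ[] p (atom (alloc x)) tr F = tr true p x here F
  Free-τ[] p (atom (|h|≥ _)) tr F = F
  Free-τ[] p (atom (|U|≥ _)) tr F = F
  Free-τ[] p (atom (|h|≥|U|- _)) tr F = F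
  Free-τ[] p (ϕ ∧ ψ) tr (∧ˡ F) = ∧ˡ (Free-τ[] p ϕ (λ q r y o → tr q r y (∧ˡ o)) F)
  Free-τ[] p (ϕ ∧ ψ) tr (∧ʳ F) = ∧ʳ (Free-τ[] p ψ (λ q r y o → tr q r y (∧ʳ o)) F)
  Free-τ[] p (¬ᵇ ϕ) tr (¬f F) = ¬f (Free-τ[] (not p) ϕ (λ q r y o → tr (not q) r y (¬ᵃ o)) F)

  module _ (S : Structure k) (μ μ' : Var → D S) where

    Transfers : Bool → Var → Set
    Transfers r y = ⟦ σ r y ⟧ S μ ⇒[ r ] ⟦ σ' r y ⟧ S μ'

    τₜ-mono : ∀ p t → (∀ x → Free x (τₜ t) → μ x ≡ μ' x) → ⟦ τₜ t ⟧ S μ ⇒[ p ] ⟦ τₜ t ⟧ S μ'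
    τₜ-mono p t eq = ⇔⇒⇒[] p (⟦⟧-coincidence S (τₜ t) eq) (⟦⟧-coincidence S (τₜ t) (λ x F → sym (eq x F)))

    -- An occurrence of polarity q inside a formula placed at polarity p has polarity
    -- (if q then p else not p) overall.
    τ[]-mono : ∀ p ϕ → (∀ x → Free x (τ ϕ) → μ x ≡ μ' x)
      → (∀ q y → AllocAt q y ϕ → Transfers (if q then p else not p) y)
      → ⟦ τ[ σ ] p ϕ ⟧ S μ ⇒[ p ] ⟦ τ[ σ' ] p ϕ ⟧ S μ'
    τ[]-mono p (atom (alloc y)) eq tr = tr true y here
    τ[]-mono p (atom t@(_ ≈ₜ _)) eq tr = τₜ-mono p t eq
    τ[]-mono p (atom t@(_ ↪ _)) eq tr = τₜ-mono p t eq
    τ[]-mono p (atom t@(|h|≥ _)) eq tr = τₜ-mono p t eq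
    τ[]-mono p (atom t@(|U|≥ _)) eq tr = τₜ-mono p t eq
    τ[]-mono p (atom t@(|h|≥|U|- _)) eq tr = τₜ-mono p t eq
    τ[]-mono p (ϕ ∧ ψ) eq tr = ×-⇒[] p
      (τ[]-mono p ϕ (λ x F → eq x (∧ˡ F)) (λ q y o → tr q y (∧ˡ o)))
      (τ[]-mono p ψ (λ x F → eq x (∧ʳ F)) (λ q y o → tr q y (∧ʳ o)))
    τ[]-mono p (¬ᵇ ϕ) eq tr = ¬-⇒[] p (τ[]-mono (not p) ϕ (λ x F → eq x (¬f F)) tr¬)
      where
      tr¬ : ∀ q y → AllocAt q y ϕ → Transfers (if q then not p else not (not p)) y
      tr¬ true y o = tr false y (¬ᵃ o)
      tr¬ false y o rewrite not-involutive p = tr true y (¬ᵃ o)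

module Blocks (K : ℕ) .{{_ : NonZero K}} where

  -- block (suc y) 0 is definitionally allocVars K y.
  block : ℕ → Var → Vec Var K
  block b y = tabulate λ i → b + (y * K + toℕ i)

  decode : {A : Set} → ℕ → (Var → Vec A K) → Var → A
  decode b f v = lookup (f ((v ∸ b) / K)) ((v ∸ b) mod K)

  decode-lookup : {A : Set} (b : ℕ) (f : Var → Vec A K) (y : Var) (i : Fin K)
    → decode b f (b + (y * K + toℕ i)) ≡ lookup (f y) i
  decode-lookup b f y i rewrite m+n∸m≡n b (y * K + toℕ i) = cong₂ (λ z j → lookup (f z) j) quotient remainder
    where
    open ≡-Reasoning
    quotient : (y * K + toℕ i) / K ≡ y
    quotient = begin
      (y * K + toℕ i) / K    ≡⟨ +-distrib-/-∣ˡ (toℕ i) (n∣m*n y) ⟩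
      y * K / K + toℕ i / K  ≡⟨ cong₂ _+_ (m*n/n≡m y K) (m<n⇒m/n≡0 (toℕ<n i)) ⟩
      y + 0                  ≡⟨ +-identityʳ y ⟩
      y                      ∎
    remainder : (y * K + toℕ i) mod K ≡ i
    remainder = toℕ-injective (begin
      toℕ ((y * K + toℕ i) mod K)  ≡⟨ toℕ-fromℕ< (m%n<n (y * K + toℕ i) K) ⟩
      (y * K + toℕ i) % K          ≡⟨ cong (_% K) (+-comm (y * K) (toℕ i)) ⟩
      (toℕ i + y * K) % K          ≡⟨ [m+kn]%n≡m%n (toℕ i) y K ⟩
      toℕ i % K                    ≡⟨ m<n⇒m%n≡m (toℕ<n i) ⟩
      toℕ i                        ∎)

  decode-block : {A : Set} (b : ℕ) (f : Var → Vec A K) (y : Var) → map (decode b f) (block b y) ≡ f y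
  decode-block b f y = begin
    map (decode b f) (block b y)                            ≡⟨ tabulate-∘ (decode b f) _ ⟨
    tabulate (λ i → decode b f (b + (y * K + toℕ i)))       ≡⟨ tabulate-cong (decode-lookup b f y) ⟩
    tabulate (lookup (f y))                                 ≡⟨ tabulate∘lookup (f y) ⟩
    f y                                                     ∎
    where open ≡-Reasoning

  region : ℕ → ℕ → List Var
  region b n = applyUpTo (b +_) (n * K)

  block⊆region : ∀ b {n y} → y < n → ∀ v → v ∈ᵛ block b y → v ∈ region b n
  block⊆region b {n} {y} y<n v = Allᵛ.lookup (tabulate⁺ {P = _∈ region b n} λ i →
    ∈-applyUpTo⁺ (b +_) (<-≤-trans (+-monoʳ-< (y * K) (toℕ<n i))
                                    (subst (_≤ n * K) (+-comm K (y * K)) (*-monoˡ-≤ K y<n))))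

  region-bounds : ∀ b n {v} → v ∈ region b n → b ≤ v × v < b + n * K
  region-bounds b n v∈ with ∈-applyUpTo⁻ (b +_) v∈
  ... | j , j<nK , refl = m≤m+n b j , +-monoʳ-< b j<nK

  Allocated⇒τalloc : (S : Structure K) (μ : Var → D S) (y : Var) → Allocated S (μ y) → ⟦ τₜ (alloc y) ⟧ S μ
  Allocated⇒τalloc S μ y (ds , H) rewrite τalloc≡∃ˡ {K} y =
    ∃ˡ-intro S (toList zs) (𝔭 (y ∷ zs)) μ μ' (≔-off μ (toList zs) g) Hμ'
    where
    zs = allocVars K y
    g = decode (suc y) (λ _ → ds)
    μ' = μ ⟨ toList zs ≔ g ⟩
    Hμ' : P S (μ' y ∷ map μ' zs) ≡ true
    Hμ' rewrite ≔-off μ (toList zs) g y (allocVars-fresh y)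
              | map-≔ μ (toList zs) g zs (λ _ → ∈-toList⁺)
              | decode-block (suc y) (λ _ → ds) 0 = H

choose : {A : Set} {B : A → Set} → Dec (Σ A B) → A → A
choose (yes (a , _)) _ = a
choose (no _) a = a

choose-correct : {A : Set} {B : A → Set} (d : Dec (Σ A B)) (a : A) → Σ A B → B (choose d a)
choose-correct (yes (_ , b)) _ _ = b
choose-correct (no ¬∃) _ ab = contradiction ab ¬∃

module Skolemisation (em : ExcludedMiddle 0ℓ) (K : ℕ) .{{_ : NonZero K}} (ys : List Var) (ϕ : BC K)
                     (ys-not-positive : ∀ y → y ∈ ys → ¬ AllocAt true y ϕ) where
  open Blocks K

  N : ℕ
  N = supVar (∀ˡ ys (τ ϕ))

  base : Bool → ℕ
  base true = N
  base false = N + N * K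

  skolemVars : Bool → List Var
  skolemVars r = region (base r) N

  W U : List Var
  W = skolemVars true
  U = skolemVars false

  skolem : Bool → Var → FO K
  skolem r y = 𝔭 (y ∷ block (base r) y)

  ψ₀ ψ : FO K
  ψ₀ = τ[ skolem ] true ϕ
  ψ = ∃ˡ W (∀ˡ ys (∀ˡ U ψ₀))

  ys<N : ∀ {y} → y ∈ ys → y < N
  ys<N = ∈⇒<supVar-∀ˡ ys (τ ϕ)

  free<N : ∀ {x} → Free x (τ ϕ) → x < N
  free<N {x} F with x ∈? ys
  ... | yes x∈ = ys<N x∈
  ... | no x∉ = Free⇒<supVar (∀ˡ ys (τ ϕ)) (Free-∀ˡ⁺ ys (τ ϕ) x∉ F)

  allocated<N : ∀ {q y} → AllocAt q y ϕ → y < N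
  allocated<N o = free<N (AllocAt⇒Free o)

  N≤base : ∀ r → N ≤ base r
  N≤base true = ≤-refl
  N≤base false = m≤m+n N (N * K)

  N≤skolemVar : ∀ r {v} → v ∈ skolemVars r → N ≤ v
  N≤skolemVar r v∈ = ≤-trans (N≤base r) (proj₁ (region-bounds (base r) N v∈))

  <N⇒∉skolemVars : ∀ r {x} → x < N → x ∉ skolemVars r
  <N⇒∉skolemVars r x<N x∈ = <⇒≱ x<N (N≤skolemVar r x∈)

  ∈W⇒∉U : ∀ {v} → v ∈ W → v ∉ U
  ∈W⇒∉U v∈W v∈U = <⇒≱ (proj₂ (region-bounds N N v∈W)) (proj₁ (region-bounds (base false) N v∈U))

  skolemVars∉ys : ∀ r {v} → v ∈ skolemVars r → v ∉ ys
  skolemVars∉ys r v∈ v∈ys = <N⇒∉skolemVars r (ys<N v∈ys) v∈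

  block⊆skolemVars : ∀ r {y} → y < N → ∀ v → v ∈ᵛ block (base r) y → v ∈ skolemVars r
  block⊆skolemVars r = block⊆region (base r)

  ψ-BSR : BSR ψ
  ψ-BSR = ∃ˡ-BSR W (univ (∀ˡ-UnivPrefix ys (∀ˡ-UnivPrefix U
            (qf (QF-τ[] skolem (λ _ _ → 𝔭q) true ϕ)))))

  module _ (S : Structure K) where

    witness : D S → Vec (D S) K
    witness d = choose (em {Allocated S d}) (replicate K (inh S))

    witness-allocates : ∀ {d} → Allocated S d → P S (d ∷ witness d) ≡ true
    witness-allocates {d} = choose-correct (em {Allocated S d}) (replicate K (inh S))

    𝔭⇒τalloc : ∀ {μ ρ : Var → D S} {y} (zs : Vec Var K) → μ y ≡ ρ y
      → ⟦ 𝔭 (y ∷ zs) ⟧ S μ → ⟦ τₜ (alloc y) ⟧ S ρ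
    𝔭⇒τalloc {μ} {ρ} {y} zs μy≡ρy H =
      Allocated⇒τalloc S ρ y (map μ zs , subst (λ d → P S (d ∷ map μ zs) ≡ true) μy≡ρy H)

    τalloc⇒𝔭 : ∀ {μ ρ : Var → D S} {y} (zs : Vec Var K) → μ y ≡ ρ y → map μ zs ≡ witness (ρ y)
      → ⟦ τₜ (alloc y) ⟧ S ρ → ⟦ 𝔭 (y ∷ zs) ⟧ S μ
    τalloc⇒𝔭 {μ} {ρ} {y} zs μy≡ρy zs↦witness H rewrite μy≡ρy | zs↦witness =
      witness-allocates (τalloc⇒Allocated y S ρ H)

    ψ₀-holds : ∀ ν μ → ⟦ ∀ˡ ys (τ ϕ) ⟧ S ν
      → (∀ v → v ∉ ys → v ∉ U → μ v ≡ (ν ⟨ W ≔ decode N (witness ∘ ν) ⟩) v) → ⟦ ψ₀ ⟧ S μ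
    ψ₀-holds ν μ H μ≡μ₁ = τ[]-mono τalloc skolem S ρ μ true ϕ ρ≡μ transfers Hρ
      where
      g : Var → D S
      g = decode N (witness ∘ ν)
      ρ : Var → D S
      ρ = ν ⟨ ys ≔ μ ⟩
      Hρ : ⟦ τ[ τalloc ] true ϕ ⟧ S ρ
      Hρ = subst (λ φ → ⟦ φ ⟧ S ρ) (τ≡τ[τalloc] true ϕ) (∀ˡ-elim S ys (τ ϕ) ν H ρ (≔-off ν ys μ))
      μ≡ν : ∀ {x} → x < N → x ∉ ys → μ x ≡ ν x
      μ≡ν x<N x∉ys = trans (μ≡μ₁ _ x∉ys (<N⇒∉skolemVars false x<N)) (≔-off ν W g _ (<N⇒∉skolemVars true x<N))
      ρ≡μ : ∀ x → Free x (τ ϕ) → ρ x ≡ μ x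
      ρ≡μ x F = ≔-cases ν ys μ μ (λ _ → refl) (λ x∉ → sym (μ≡ν (free<N F) x∉))
      transfers : ∀ q y → AllocAt q y ϕ → Transfers τalloc skolem S ρ μ (if q then true else false) y
      -- A positive alloc(y) has y ∉ ys, so ρ y = ν y and the witness chosen for ν y serves.
      transfers true y o = τalloc⇒𝔭 (block N y) μy≡ρy block↦witness
        where
        y<N = allocated<N o
        y∉ys : y ∉ ys
        y∉ys y∈ = ys-not-positive y y∈ o
        ρy≡νy : ρ y ≡ ν y
        ρy≡νy = ≔-off ν ys μ y y∉ys
        μy≡ρy : μ y ≡ ρ y
        μy≡ρy = trans (μ≡ν y<N y∉ys) (sym ρy≡νy)
        inW = block⊆skolemVars true y<N
        block↦witness : map μ (block N y) ≡ witness (ρ y)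
        block↦witness = begin
          map μ (block N y)                 ≡⟨ map-cong-∈ (block N y) (λ v v∈ →
                                                 μ≡μ₁ v (skolemVars∉ys true (inW v v∈)) (∈W⇒∉U (inW v v∈))) ⟩
          map (ν ⟨ W ≔ g ⟩) (block N y)     ≡⟨ map-≔ ν W g (block N y) inW ⟩
          map g (block N y)                 ≡⟨ decode-block N (witness ∘ ν) y ⟩
          witness (ν y)                     ≡⟨ cong witness ρy≡νy ⟨
          witness (ρ y)                     ∎
          where open ≡-Reasoning
      transfers false y o = 𝔭⇒τalloc (block (base false) y) (sym (ρ≡μ y (AllocAt⇒Free o)))

    sound : ∀ ν → ⟦ ∀ˡ ys (τ ϕ) ⟧ S ν → ⟦ ψ ⟧ S ν
    sound ν H = ∃ˡ-intro S W _ ν μ₁ (≔-off ν W g) (∀ˡ-intro S ys _ μ₁ λ μ₂ μ₂≗μ₁ →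
                  ∀ˡ-intro S U ψ₀ μ₂ λ μ₃ μ₃≗μ₂ →
                    ψ₀-holds ν μ₃ H (λ v v∉ys v∉U → trans (μ₃≗μ₂ v v∉U) (μ₂≗μ₁ v v∉ys)))
      where
      g μ₁ : Var → D S
      g = decode N (witness ∘ ν)
      μ₁ = ν ⟨ W ≔ g ⟩

    τϕ-holds : ∀ μ ρ → ⟦ ∀ˡ ys (∀ˡ U ψ₀) ⟧ S μ → (∀ x → x ∉ ys → x ∉ W → μ x ≡ ρ x) → ⟦ τ ϕ ⟧ S ρ
    τϕ-holds μ ρ G μ≡ρ = subst (λ φ → ⟦ φ ⟧ S ρ) (sym (τ≡τ[τalloc] true ϕ))
                           (τ[]-mono skolem τalloc S μ₂ ρ true ϕ μ₂≡ρ transfers G₂)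
      where
      g : Var → D S
      g = decode (base false) (witness ∘ ρ)
      μ₁ μ₂ : Var → D S
      μ₁ = μ ⟨ ys ≔ ρ ⟩
      μ₂ = μ₁ ⟨ U ≔ g ⟩
      G₂ : ⟦ ψ₀ ⟧ S μ₂
      G₂ = ∀ˡ-elim S U ψ₀ μ₁ (∀ˡ-elim S ys _ μ G μ₁ (≔-off μ ys ρ)) μ₂ (≔-off μ₁ U g)
      μ₂≡ρ : ∀ x → Free x (τ ϕ) → μ₂ x ≡ ρ x
      μ₂≡ρ x F = trans (≔-off μ₁ U g x (<N⇒∉skolemVars false (free<N F)))
        (≔-cases μ ys ρ ρ (λ _ → refl) (λ x∉ → μ≡ρ x x∉ (<N⇒∉skolemVars true (free<N F))))
      transfers : ∀ q y → AllocAt q y ϕ → Transfers skolem τalloc S μ₂ ρ (if q then true else false) y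
      transfers true y o = 𝔭⇒τalloc (block N y) (μ₂≡ρ y (AllocAt⇒Free o))
      transfers false y o = τalloc⇒𝔭 (block (base false) y) (μ₂≡ρ y (AllocAt⇒Free o))
        (trans (map-≔ μ₁ U g _ (block⊆skolemVars false (allocated<N o))) (decode-block (base false) (witness ∘ ρ) y))

    complete : ∀ ν → ⟦ ψ ⟧ S ν → ⟦ ∀ˡ ys (τ ϕ) ⟧ S ν
    complete ν G with ∃ˡ-elim S W _ ν G
    ... | μ , μ≗ν , Gμ = ∀ˡ-intro S ys (τ ϕ) ν λ ρ ρ≗ν →
      τϕ-holds μ ρ Gμ (λ x x∉ys x∉W → trans (μ≗ν x x∉W) (sym (ρ≗ν x x∉ys)))

  ψ-constants : ∀ c → HasConst c ψ ⇔ HasConst c (∀ˡ ys (τ ϕ))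
  ψ-constants c = mk⇔ to from
    where
    to : HasConst c ψ → HasConst c (∀ˡ ys (τ ϕ))
    to H = HasConst-∀ˡ⁺ ys (τ ϕ) (subst (HasConst c) (sym (τ≡τ[τalloc] true ϕ))
             (HasConst-τ[] skolem τalloc (λ _ _ ()) true ϕ
               (HasConst-∀ˡ⁻ U ψ₀ (HasConst-∀ˡ⁻ ys _ (HasConst-∃ˡ⁻ W _ H)))))
    from : HasConst c (∀ˡ ys (τ ϕ)) → HasConst c ψ
    from H = HasConst-∃ˡ⁺ W _ (HasConst-∀ˡ⁺ ys _ (HasConst-∀ˡ⁺ U ψ₀
               (HasConst-τ[] τalloc skolem (λ _ y → ¬HasConst-τalloc y) true ϕ
                 (subst (HasConst c) (τ≡τ[τalloc] true ϕ) (HasConst-∀ˡ⁻ ys (τ ϕ) H)))))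

  ψ-free : ∀ x → Free x ψ ⇔ Free x (∀ˡ ys (τ ϕ))
  ψ-free x = mk⇔ to from
    where
    to : Free x ψ → Free x (∀ˡ ys (τ ϕ))
    to F with Free-∃ˡ⁻ W _ F
    ... | x∉W , F₁ with Free-∀ˡ⁻ ys _ F₁
    ... | x∉ys , F₂ with Free-∀ˡ⁻ U ψ₀ F₂
    ... | x∉U , F₃ = Free-∀ˡ⁺ ys (τ ϕ) x∉ys (subst (Free x) (sym (τ≡τ[τalloc] true ϕ))
                       (Free-τ[] skolem τalloc true ϕ skolem→τalloc F₃))
      where
      x∉skolemVars : ∀ r → x ∉ skolemVars r
      x∉skolemVars true = x∉W
      x∉skolemVars false = x∉U
      skolem→τalloc : ∀ q r y → AllocAt q y ϕ → Free x (skolem r y) → Free x (τalloc r y)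
      skolem→τalloc q r y o (𝔭∈ (here refl)) = Free-τalloc⁺ x
      skolem→τalloc q r y o (𝔭∈ (there x∈)) =
        contradiction (block⊆skolemVars r (allocated<N o) x x∈) (x∉skolemVars r)
    from : Free x (∀ˡ ys (τ ϕ)) → Free x ψ
    from F with Free-∀ˡ⁻ ys (τ ϕ) F
    ... | x∉ys , F₁ = Free-∃ˡ⁺ W _ (<N⇒∉skolemVars true x<N) (Free-∀ˡ⁺ ys _ x∉ys
                        (Free-∀ˡ⁺ U ψ₀ (<N⇒∉skolemVars false x<N)
                          (Free-τ[] τalloc skolem true ϕ τalloc→skolem (subst (Free x) (τ≡τ[τalloc] true ϕ) F₁))))
      where
      x<N = free<N F₁
      τalloc→skolem : ∀ q r y → AllocAt q y ϕ → Free x (τalloc r y) → Free x (skolem r y)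
      τalloc→skolem q r y o F' with Free-τalloc⁻ y F'
      ... | refl = 𝔭∈ (here refl)

lemma2 : ExcludedMiddle 0ℓ → (k : ℕ) → 1 ≤ k → (ys : List Var) → (ϕ : BC k)
    → (∀ y → y ∈ ys → ¬ AllocAt true y ϕ)
    → Σ (FO k) λ ψ → BSR ψ × (∀ˡ ys (τ ϕ) ≡ᶠ ψ)
        × (∀ c → HasConst c ψ ⇔ HasConst c (∀ˡ ys (τ ϕ)))
        × (∀ x → Free x ψ ⇔ Free x (∀ˡ ys (τ ϕ)))
lemma2 em (suc K') (s≤s z≤n) ys ϕ ys-not-positive =
  ψ , ψ-BSR , (λ S ν → mk⇔ (sound S ν) (complete S ν)) , ψ-constants , ψ-free
  where open Skolemisation em (suc K') ys ϕ ys-not-positive
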